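{- Let $G$ be a hot short game. Suppose there are a number $K$ and an infinitesimal $\epsilon$ such that $G^L-G-K+\epsilon\leq 0$ for every Left option $G^L$ of $G$. Then $\ell(G)\leq K$.
   Context: Short normal-play games; $G+H$ is the disjunctive sum, $-G=\{ -G^{\mathcal R}\mid-G^{\mathcal L}\}$, $G-H=G+(-H)$. $G\le 0$ means Right wins $G$ when Left moves first. Numbers are the usual combinatorial game numbers. Stops: if $G$ equals a number $x$ then $LS(G)=RS(G)=x$; otherwise $LS(G)=\max_{G^L}RS(G^L)$, $RS(G)=\min_{G^R}LS(G^R)$; $\ell(G)=LS(G)-RS(G)$. A game $\epsilon$ is infinitesimal if $LS(\epsilon)=RS(\epsilon)=0$. $G$ is hot if its temperature is positive, equivalently $LS(G)>RS(G)$. -}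

module Defs where

open import Data.Nat using (ℕ; _+_)
open import Data.Fin using (Fin; splitAt)
open import Data.Sum using (_⊎_; [_,_]′)
open import Data.Product using (Σ; _×_)
open import Relation.Nullary using (¬_)

data Game : Set where
  ⟨_∣_⟩ : {m n : ℕ} → (Fin m → Game) → (Fin n → Game) → Game

nL : Game → ℕ
nL (⟨_∣_⟩ {m} _ _) = m

nR : Game → ℕ
nR (⟨_∣_⟩ {_} {n} _ _) = n

GL : (G : Game) → Fin (nL G) → Game
GL ⟨ L ∣ _ ⟩ = L

GR : (G : Game) → Fin (nR G) → Game
GR ⟨ _ ∣ R ⟩ = R

0g : Game
0g = ⟨_∣_⟩ {0} {0} (λ ()) (λ ())

_⊕_ : {A : Set} {m n : ℕ} → (Fin m → A) → (Fin n → A) → Fin (m + n) → A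
_⊕_ {m = m} f g k = [ f , g ]′ (splitAt m k)

infixl 6 _+g_ _-g_
_+g_ : Game → Game → Game
⟨ L ∣ R ⟩ +g ⟨ L′ ∣ R′ ⟩ =
  ⟨ (λ i → L i +g ⟨ L′ ∣ R′ ⟩) ⊕ (λ i → ⟨ L ∣ R ⟩ +g L′ i)
  ∣ (λ j → R j +g ⟨ L′ ∣ R′ ⟩) ⊕ (λ j → ⟨ L ∣ R ⟩ +g R′ j) ⟩

-g_ : Game → Game
-g ⟨ L ∣ R ⟩ = ⟨ (λ j → -g (R j)) ∣ (λ i → -g (L i)) ⟩

_-g_ : Game → Game → Game
G -g H = G +g (-g H)

-- Conway order: G ≤ H iff no G^L with H ≤ G^L and no H^R with H^R ≤ G.
-- G ⧏ H ("G less than or confused with H") is the negation-free dual.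
infix 4 _≤g_ _⧏_ _≈g_ _<g_
mutual
  _≤g_ : Game → Game → Set
  ⟨ L ∣ R ⟩ ≤g ⟨ L′ ∣ R′ ⟩ =
    ((i : _) → L i ⧏ ⟨ L′ ∣ R′ ⟩) × ((j : _) → ⟨ L ∣ R ⟩ ⧏ R′ j)

  _⧏_ : Game → Game → Set
  ⟨ L ∣ R ⟩ ⧏ ⟨ L′ ∣ R′ ⟩ =
    Σ _ (λ i → ⟨ L ∣ R ⟩ ≤g L′ i) ⊎ Σ _ (λ j → R j ≤g ⟨ L′ ∣ R′ ⟩)

_≈g_ : Game → Game → Set
G ≈g H = (G ≤g H) × (H ≤g G)

_<g_ : Game → Game → Set
G <g H = (G ≤g H) × ¬ (H ≤g G)

IsNumber : Game → Set
IsNumber ⟨ L ∣ R ⟩ =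
  ((i : _) → IsNumber (L i)) × ((j : _) → IsNumber (R j)) ×
  ((i : _) (j : _) → L i <g R j)

EqNumber : Game → Set
EqNumber G = Σ Game (λ x → IsNumber x × (G ≈g x))

-- Stops, as relations "LS(G) = x", "RS(G) = x" (values are number forms,
-- determined up to ≈g):
--  if G equals a number x, LS(G) = RS(G) = x;
--  otherwise LS(G) = max over G^L of RS(G^L), RS(G) = min over G^R of LS(G^R).
mutual
  LeftStop : Game → Game → Set
  LeftStop ⟨ L ∣ R ⟩ x =
    (IsNumber x × (⟨ L ∣ R ⟩ ≈g x)) ⊎
    (¬ EqNumber ⟨ L ∣ R ⟩ ×
     Σ _ (λ i → RightStop (L i) x) ×
     ((i : _) (y : Game) → RightStop (L i) y → y ≤g x))

  RightStop : Game → Game → Set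
  RightStop ⟨ L ∣ R ⟩ x =
    (IsNumber x × (⟨ L ∣ R ⟩ ≈g x)) ⊎
    (¬ EqNumber ⟨ L ∣ R ⟩ ×
     Σ _ (λ j → LeftStop (R j) x) ×
     ((j : _) (y : Game) → LeftStop (R j) y → x ≤g y))

Infinitesimal : Game → Set
Infinitesimal ε = LeftStop ε 0g × RightStop ε 0g

Hot : Game → Set
Hot G = Σ Game (λ a → Σ Game (λ b → LeftStop G a × RightStop G b × (b <g a)))

module Submission where

-- A hot game is not a number, so LS(G) = a is the Right stop of some
-- Left option A and RS(G) = b is the Left stop of some Right option B.  If
-- a - b ≰ K, then K < a - b for these numbers, and the gap splits into numbers
-- y < a and z > b with S = (y - z) - K > 0.  Comparing games with numbers
-- through their stops gives y ≤ A, B ≤ z and -S ≤ ε (since RS(ε) = 0 > -S),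
-- so 0 ≤ S - S ≤ (A - B - K) + ε.  That game is a Left option of
-- (A - G - K) + ε ≤ 0, a contradiction; as ≤ is decidable, a - b ≤ K.

open import Defs
open import Data.Nat using (ℕ; zero; suc; _⊔_; z≤n; s≤s) renaming (_≤_ to _≤ℕ_)
open import Data.Nat.Properties using (m≤m⊔n; m≤n⊔m)
open import Data.Fin using (Fin; zero; suc; splitAt; _↑ˡ_; _↑ʳ_)
open import Data.Fin.Properties using (splitAt-↑ˡ; splitAt-↑ʳ; any?; all?; ¬∀⟶∃¬)
open import Data.Sum using (_⊎_; inj₁; inj₂; [_,_]′)
open import Data.Product using (Σ; _×_; _,_; proj₁; proj₂; uncurry)
open import Data.Empty using (⊥; ⊥-elim)
open import Function using (_∘_; id)
open import Relation.Nullary using (¬_; Dec; yes; no)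
open import Relation.Nullary.Negation using (DoubleNegation; ¬¬-Monad; ¬¬-map)
open import Relation.Nullary.Decidable using (¬¬-excluded-middle; decidable-stable)
open import Effect.Monad using (RawMonad)
open import Level using (0ℓ)
open import Relation.Binary.PropositionalEquality using (_≡_; subst; cong)
open import Relation.Binary.Bundles using (Setoid)

open RawMonad (¬¬-Monad {0ℓ}) using (_>>=_; pure)

-- The Conway order.

mutual
  ≤-trans : ∀ X Y Z → X ≤g Y → Y ≤g Z → X ≤g Z
  ≤-trans ⟨ XL ∣ XR ⟩ Y@(⟨ _ ∣ _ ⟩) Z@(⟨ _ ∣ ZR ⟩) X≤Y@(XL⧏Y , _) Y≤Z =
    (λ i → ⧏≤-trans (XL i) Y Z (XL⧏Y i) Y≤Z) ,
    (λ j → ≤⧏-trans ⟨ XL ∣ XR ⟩ Y (ZR j) X≤Y (proj₂ Y≤Z j))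

  ⧏≤-trans : ∀ X Y Z → X ⧏ Y → Y ≤g Z → X ⧏ Z
  ⧏≤-trans X@(⟨ _ ∣ _ ⟩) ⟨ YL ∣ _ ⟩ Z@(⟨ _ ∣ _ ⟩) (inj₁ (i , X≤YLi)) (YL⧏Z , _) =
    ≤⧏-trans X (YL i) Z X≤YLi (YL⧏Z i)
  ⧏≤-trans ⟨ _ ∣ XR ⟩ Y@(⟨ _ ∣ _ ⟩) Z@(⟨ _ ∣ _ ⟩) (inj₂ (j , XRj≤Y)) Y≤Z =
    inj₂ (j , ≤-trans (XR j) Y Z XRj≤Y Y≤Z)

  ≤⧏-trans : ∀ X Y Z → X ≤g Y → Y ⧏ Z → X ⧏ Z
  ≤⧏-trans X@(⟨ _ ∣ _ ⟩) Y@(⟨ _ ∣ _ ⟩) ⟨ ZL ∣ _ ⟩ X≤Y (inj₁ (k , Y≤ZLk)) =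
    inj₁ (k , ≤-trans X Y (ZL k) X≤Y Y≤ZLk)
  ≤⧏-trans X@(⟨ _ ∣ _ ⟩) ⟨ _ ∣ YR ⟩ Z@(⟨ _ ∣ _ ⟩) (_ , X⧏YR) (inj₂ (j , YRj≤Z)) =
    ⧏≤-trans X (YR j) Z (X⧏YR j) YRj≤Z

-- Introduction and elimination rules for games that are not in constructor form.
⧏-viaL : ∀ X G i → X ≤g GL G i → X ⧏ G
⧏-viaL ⟨ _ ∣ _ ⟩ ⟨ _ ∣ _ ⟩ i X≤GLi = inj₁ (i , X≤GLi)

⧏-viaR : ∀ G Y j → GR G j ≤g Y → G ⧏ Y
⧏-viaR ⟨ _ ∣ _ ⟩ ⟨ _ ∣ _ ⟩ j GRj≤Y = inj₂ (j , GRj≤Y)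

≤-elimL : ∀ G Y → G ≤g Y → ∀ i → GL G i ⧏ Y
≤-elimL ⟨ _ ∣ _ ⟩ ⟨ _ ∣ _ ⟩ = proj₁

≤-elimR : ∀ X G → X ≤g G → ∀ j → X ⧏ GR G j
≤-elimR ⟨ _ ∣ _ ⟩ ⟨ _ ∣ _ ⟩ = proj₂

≤-intro : ∀ X Y → (∀ i → GL X i ⧏ Y) → (∀ j → X ⧏ GR Y j) → X ≤g Y
≤-intro ⟨ _ ∣ _ ⟩ ⟨ _ ∣ _ ⟩ = _,_

⧏-elim : ∀ X Y → X ⧏ Y → Σ _ (λ i → X ≤g GL Y i) ⊎ Σ _ (λ j → GR X j ≤g Y)
⧏-elim ⟨ _ ∣ _ ⟩ ⟨ _ ∣ _ ⟩ X⧏Y = X⧏Y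

≤-refl : ∀ G → G ≤g G
≤-refl G@(⟨ L ∣ R ⟩) = (λ i → ⧏-viaL (L i) G i (≤-refl (L i))) ,
                       (λ j → ⧏-viaR G (R j) j (≤-refl (R j)))

GL⧏ : ∀ G i → GL G i ⧏ G
GL⧏ G = ≤-elimL G G (≤-refl G)

⧏GR : ∀ G j → G ⧏ GR G j
⧏GR G = ≤-elimR G G (≤-refl G)

≤⧏-absurd : ∀ X Y → X ≤g Y → Y ⧏ X → ⊥
≤⧏-absurd ⟨ XL ∣ _ ⟩ Y@(⟨ _ ∣ _ ⟩) (XL⧏Y , _) (inj₁ (i , Y≤XLi)) = ≤⧏-absurd Y (XL i) Y≤XLi (XL⧏Y i)
≤⧏-absurd X@(⟨ _ ∣ _ ⟩) ⟨ _ ∣ YR ⟩ (_ , X⧏YR) (inj₂ (j , YRj≤X)) = ≤⧏-absurd (YR j) X YRj≤X (X⧏YR j)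

-- Both relations are decidable, since games have finitely many options.
mutual
  _≤?_ : ∀ X Y → Dec (X ≤g Y)
  X@(⟨ XL ∣ _ ⟩) ≤? Y@(⟨ _ ∣ YR ⟩) with all? (λ i → XL i ⧏? Y) | all? (λ j → X ⧏? YR j)
  ... | yes XL⧏Y | yes X⧏YR = yes (XL⧏Y , X⧏YR)
  ... | no ¬XL⧏Y | _        = no (¬XL⧏Y ∘ proj₁)
  ... | yes _    | no ¬X⧏YR = no (¬X⧏YR ∘ proj₂)

  _⧏?_ : ∀ X Y → Dec (X ⧏ Y)
  X@(⟨ _ ∣ XR ⟩) ⧏? Y@(⟨ YL ∣ _ ⟩) with any? (λ i → X ≤? YL i) | any? (λ j → XR j ≤? Y)
  ... | yes viaL | _        = yes (inj₁ viaL)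
  ... | no _     | yes viaR = yes (inj₂ viaR)
  ... | no ¬viaL | no ¬viaR = no λ { (inj₁ viaL) → ¬viaL viaL ; (inj₂ viaR) → ¬viaR viaR }

all-or-counterexample : ∀ {n} {P : Fin n → Set} → (∀ i → Dec (P i)) →
                        (∀ i → P i) ⊎ Σ (Fin n) (λ i → ¬ P i)
all-or-counterexample {n} P? with all? P?
... | yes all = inj₁ all
... | no ¬all = inj₂ (¬∀⟶∃¬ n _ P? ¬all)

mutual
  ¬≤⇒⧏ : ∀ X Y → ¬ (X ≤g Y) → Y ⧏ X
  ¬≤⇒⧏ ⟨ XL ∣ XR ⟩ ⟨ YL ∣ YR ⟩ X≰Y =
    [ (λ XL⧏Y → [ (λ X⧏YR → ⊥-elim (X≰Y (XL⧏Y , X⧏YR))) ,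
                  (uncurry λ j X⋪YRj → inj₂ (j , ¬⧏⇒≤ ⟨ XL ∣ XR ⟩ (YR j) X⋪YRj)) ]′
                (all-or-counterexample (λ j → ⟨ XL ∣ XR ⟩ ⧏? YR j))) ,
      (uncurry λ i XLi⋪Y → inj₁ (i , ¬⧏⇒≤ (XL i) ⟨ YL ∣ YR ⟩ XLi⋪Y)) ]′
    (all-or-counterexample (λ i → XL i ⧏? ⟨ YL ∣ YR ⟩))

  ¬⧏⇒≤ : ∀ X Y → ¬ (X ⧏ Y) → Y ≤g X
  ¬⧏⇒≤ ⟨ XL ∣ XR ⟩ ⟨ YL ∣ YR ⟩ X⋪Y =
    (λ i → ¬≤⇒⧏ ⟨ XL ∣ XR ⟩ (YL i) (λ X≤YLi → X⋪Y (inj₁ (i , X≤YLi)))) ,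
    (λ j → ¬≤⇒⧏ (XR j) ⟨ YL ∣ YR ⟩ (λ XRj≤Y → X⋪Y (inj₂ (j , XRj≤Y))))

-- "X is a Left (Right) option of G", as an inductive relation so that G and X
-- can be inferred.
data LeftOption (G : Game) : Game → Set where
  isLeft : (i : Fin (nL G)) → LeftOption G (GL G i)

data RightOption (G : Game) : Game → Set where
  isRight : (j : Fin (nR G)) → RightOption G (GR G j)

⧏-left : ∀ {X Y Z} → LeftOption Y Z → X ≤g Z → X ⧏ Y
⧏-left {X} {Y} (isLeft i) = ⧏-viaL X Y i

⧏-right : ∀ {X Y Z} → RightOption X Z → Z ≤g Y → X ⧏ Y
⧏-right {X} {Y} (isRight j) = ⧏-viaR X Y j

⊕-inl : ∀ {A : Set} {m n} (f : Fin m → A) (g : Fin n → A) i → (f ⊕ g) (i ↑ˡ n) ≡ f i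
⊕-inl {m = m} {n} f g i = cong [ f , g ]′ (splitAt-↑ˡ m i n)

⊕-inr : ∀ {A : Set} {m n} (f : Fin m → A) (g : Fin n → A) i → (f ⊕ g) (m ↑ʳ i) ≡ g i
⊕-inr {m = m} {n} f g i = cong [ f , g ]′ (splitAt-↑ʳ m n i)

⊕-ind : ∀ {A : Set} {m n} (P : A → Set) (f : Fin m → A) (g : Fin n → A) →
        (∀ i → P (f i)) → (∀ i → P (g i)) → ∀ k → P ((f ⊕ g) k)
⊕-ind {m = m} P f g Pf Pg k with splitAt m k
... | inj₁ i = Pf i
... | inj₂ i = Pg i

+-leftOptionˡ : ∀ {G X} H → LeftOption G X → LeftOption (G +g H) (X +g H)
+-leftOptionˡ {⟨ L ∣ R ⟩} ⟨ L′ ∣ R′ ⟩ (isLeft i) =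
  subst (LeftOption _) (⊕-inl _ (λ i → ⟨ L ∣ R ⟩ +g L′ i) i) (isLeft (i ↑ˡ _))

+-leftOptionʳ : ∀ G {H X} → LeftOption H X → LeftOption (G +g H) (G +g X)
+-leftOptionʳ ⟨ L ∣ R ⟩ {⟨ L′ ∣ R′ ⟩} (isLeft i) =
  subst (LeftOption _) (⊕-inr (λ i → L i +g ⟨ L′ ∣ R′ ⟩) _ i) (isLeft (_ ↑ʳ i))

+-rightOptionˡ : ∀ {G X} H → RightOption G X → RightOption (G +g H) (X +g H)
+-rightOptionˡ {⟨ L ∣ R ⟩} ⟨ L′ ∣ R′ ⟩ (isRight j) =
  subst (RightOption _) (⊕-inl _ (λ j → ⟨ L ∣ R ⟩ +g R′ j) j) (isRight (j ↑ˡ _))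

+-rightOptionʳ : ∀ G {H X} → RightOption H X → RightOption (G +g H) (G +g X)
+-rightOptionʳ ⟨ L ∣ R ⟩ {⟨ L′ ∣ R′ ⟩} (isRight j) =
  subst (RightOption _) (⊕-inr (λ j → R j +g ⟨ L′ ∣ R′ ⟩) _ j) (isRight (_ ↑ʳ j))

+-leftOptions-ind : ∀ G H (P : Game → Set) → (∀ i → P (GL G i +g H)) → (∀ i → P (G +g GL H i)) →
                    ∀ k → P (GL (G +g H) k)
+-leftOptions-ind ⟨ L ∣ R ⟩ ⟨ L′ ∣ R′ ⟩ P = ⊕-ind P _ _

+-rightOptions-ind : ∀ G H (P : Game → Set) → (∀ j → P (GR G j +g H)) → (∀ j → P (G +g GR H j)) →
                     ∀ k → P (GR (G +g H) k)
+-rightOptions-ind ⟨ L ∣ R ⟩ ⟨ L′ ∣ R′ ⟩ P = ⊕-ind P _ _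

+≤-intro : ∀ G H Y → (∀ i → GL G i +g H ⧏ Y) → (∀ i → G +g GL H i ⧏ Y) →
           (∀ j → G +g H ⧏ GR Y j) → G +g H ≤g Y
+≤-intro G H Y GL+H⧏Y G+HL⧏Y G+H⧏YR =
  ≤-intro (G +g H) Y (+-leftOptions-ind G H (_⧏ Y) GL+H⧏Y G+HL⧏Y) G+H⧏YR

≤+-intro : ∀ X G H → (∀ i → GL X i ⧏ G +g H) → (∀ j → X ⧏ GR G j +g H) → (∀ j → X ⧏ G +g GR H j) →
           X ≤g G +g H
≤+-intro X G H XL⧏G+H X⧏GR+H X⧏G+HR =
  ≤-intro X (G +g H) XL⧏G+H (+-rightOptions-ind G H (X ⧏_) X⧏GR+H X⧏G+HR)

mutual
  +-monoˡ-≤ : ∀ G H X → G ≤g H → G +g X ≤g H +g X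
  +-monoˡ-≤ G@(⟨ GL′ ∣ _ ⟩) H@(⟨ _ ∣ HR ⟩) X@(⟨ XL ∣ XR ⟩) G≤H@(GL⧏H , G⧏HR) =
    +≤-intro G X (H +g X)
      (λ i → +-monoˡ-⧏ (GL′ i) H X (GL⧏H i))
      (λ i → ⧏-left (+-leftOptionʳ H (isLeft i)) (+-monoˡ-≤ G H (XL i) G≤H))
      (+-rightOptions-ind H X (λ Z → G +g X ⧏ Z)
        (λ j → +-monoˡ-⧏ G (HR j) X (G⧏HR j))
        (λ j → ⧏-right (+-rightOptionʳ G (isRight j)) (+-monoˡ-≤ G H (XR j) G≤H)))

  +-monoˡ-⧏ : ∀ G H X → G ⧏ H → G +g X ⧏ H +g X
  +-monoˡ-⧏ G@(⟨ _ ∣ _ ⟩) ⟨ HL ∣ HR ⟩ X@(⟨ _ ∣ _ ⟩) (inj₁ (i , G≤HLi)) =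
    ⧏-left (+-leftOptionˡ X (isLeft i)) (+-monoˡ-≤ G (HL i) X G≤HLi)
  +-monoˡ-⧏ ⟨ GL′ ∣ GR′ ⟩ H@(⟨ _ ∣ _ ⟩) X@(⟨ _ ∣ _ ⟩) (inj₂ (j , GRj≤H)) =
    ⧏-right (+-rightOptionˡ X (isRight j)) (+-monoˡ-≤ (GR′ j) H X GRj≤H)

+-comm-≤ : ∀ G H → G +g H ≤g H +g G
+-comm-≤ G@(⟨ GL′ ∣ GR′ ⟩) H@(⟨ HL ∣ HR ⟩) =
  +≤-intro G H (H +g G)
    (λ i → ⧏-left (+-leftOptionʳ H (isLeft i)) (+-comm-≤ (GL′ i) H))
    (λ i → ⧏-left (+-leftOptionˡ G (isLeft i)) (+-comm-≤ G (HL i)))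
    (+-rightOptions-ind H G (λ Z → G +g H ⧏ Z)
      (λ j → ⧏-right (+-rightOptionʳ G (isRight j)) (+-comm-≤ G (HR j)))
      (λ j → ⧏-right (+-rightOptionˡ H (isRight j)) (+-comm-≤ (GR′ j) H)))

+-assoc-≤ : ∀ G H J → (G +g H) +g J ≤g G +g (H +g J)
+-assoc-≤ G@(⟨ GL′ ∣ GR′ ⟩) H@(⟨ HL ∣ HR ⟩) J@(⟨ JL ∣ JR ⟩) =
  +≤-intro (G +g H) J (G +g (H +g J))
    (+-leftOptions-ind G H (λ Z → Z +g J ⧏ G +g (H +g J))
      (λ i → ⧏-left (+-leftOptionˡ (H +g J) (isLeft i)) (+-assoc-≤ (GL′ i) H J))
      (λ i → ⧏-left (+-leftOptionʳ G (+-leftOptionˡ J (isLeft i))) (+-assoc-≤ G (HL i) J)))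
    (λ i → ⧏-left (+-leftOptionʳ G (+-leftOptionʳ H (isLeft i))) (+-assoc-≤ G H (JL i)))
    (+-rightOptions-ind G (H +g J) (λ Z → (G +g H) +g J ⧏ Z)
      (λ j → ⧏-right (+-rightOptionˡ J (+-rightOptionˡ H (isRight j))) (+-assoc-≤ (GR′ j) H J))
      (+-rightOptions-ind H J (λ Z → (G +g H) +g J ⧏ G +g Z)
        (λ j → ⧏-right (+-rightOptionˡ J (+-rightOptionʳ G (isRight j))) (+-assoc-≤ G (HR j) J))
        (λ j → ⧏-right (+-rightOptionʳ (G +g H) (isRight j)) (+-assoc-≤ G H (JR j)))))

+-assoc-≥ : ∀ G H J → G +g (H +g J) ≤g (G +g H) +g J
+-assoc-≥ G H J =
  ≤-trans _ _ _ (+-comm-≤ G (H +g J))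
  (≤-trans _ _ _ (+-assoc-≤ H J G)
  (≤-trans _ _ _ (+-comm-≤ H (J +g G))
  (≤-trans _ _ _ (+-assoc-≤ J G H)
  (+-comm-≤ J (G +g H)))))

-- 0 is a right identity, and G - G ≈ 0 (Right answers each move by the mirror move).
+-identityʳ-≤ : ∀ G → G +g 0g ≤g G
+-identityʳ-≤ G@(⟨ L ∣ R ⟩) =
  +≤-intro G 0g G
    (λ i → ⧏-viaL (L i +g 0g) G i (+-identityʳ-≤ (L i))) (λ ())
    (λ j → ⧏-right (+-rightOptionˡ 0g (isRight j)) (+-identityʳ-≤ (R j)))

+-identityʳ-≥ : ∀ G → G ≤g G +g 0g
+-identityʳ-≥ G@(⟨ L ∣ R ⟩) =
  ≤+-intro G G 0g
    (λ i → ⧏-left (+-leftOptionˡ 0g (isLeft i)) (+-identityʳ-≥ (L i)))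
    (λ j → ⧏-viaR G (R j +g 0g) j (+-identityʳ-≥ (R j))) (λ ())

+-inverseʳ-≤ : ∀ G → G -g G ≤g 0g
+-inverseʳ-≤ G@(⟨ L ∣ R ⟩) =
  +≤-intro G (-g G) 0g
    (λ i → ⧏-right (+-rightOptionʳ (L i) (isRight i)) (+-inverseʳ-≤ (L i)))
    (λ j → ⧏-right (+-rightOptionˡ (-g (R j)) (isRight j)) (+-inverseʳ-≤ (R j)))
    (λ ())

+-inverseʳ-≥ : ∀ G → 0g ≤g G -g G
+-inverseʳ-≥ G@(⟨ L ∣ R ⟩) =
  ≤+-intro 0g G (-g G) (λ ())
    (λ j → ⧏-left (+-leftOptionʳ (R j) (isLeft j)) (+-inverseʳ-≥ (R j)))
    (λ i → ⧏-left (+-leftOptionˡ (-g (L i)) (isLeft i)) (+-inverseʳ-≥ (L i)))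

mutual
  -‿anti-≤ : ∀ G H → G ≤g H → -g H ≤g -g G
  -‿anti-≤ G@(⟨ GL′ ∣ _ ⟩) H@(⟨ _ ∣ HR ⟩) (GL⧏H , G⧏HR) =
    (λ j → -‿anti-⧏ G (HR j) (G⧏HR j)) , (λ i → -‿anti-⧏ (GL′ i) H (GL⧏H i))

  -‿anti-⧏ : ∀ G H → G ⧏ H → -g H ⧏ -g G
  -‿anti-⧏ G@(⟨ _ ∣ _ ⟩) ⟨ HL ∣ _ ⟩ (inj₁ (i , G≤HLi)) = inj₂ (i , -‿anti-≤ G (HL i) G≤HLi)
  -‿anti-⧏ ⟨ _ ∣ GR′ ⟩ H@(⟨ _ ∣ _ ⟩) (inj₂ (j , GRj≤H)) = inj₁ (j , -‿anti-≤ (GR′ j) H GRj≤H)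

-‿involutive-≤ : ∀ G → -g (-g G) ≤g G
-‿involutive-≤ G@(⟨ L ∣ R ⟩) =
  (λ i → ⧏-viaL (-g (-g (L i))) G i (-‿involutive-≤ (L i))) ,
  (λ j → ⧏-viaR (-g (-g G)) (R j) j (-‿involutive-≤ (R j)))

-‿involutive-≥ : ∀ G → G ≤g -g (-g G)
-‿involutive-≥ G@(⟨ L ∣ R ⟩) =
  (λ i → ⧏-viaL (L i) (-g (-g G)) i (-‿involutive-≥ (L i))) ,
  (λ j → ⧏-viaR G (-g (-g (R j))) j (-‿involutive-≥ (R j)))

+-monoʳ-≤ : ∀ G H X → G ≤g H → X +g G ≤g X +g H
+-monoʳ-≤ G H X G≤H =
  ≤-trans _ _ _ (+-comm-≤ X G) (≤-trans _ _ _ (+-monoˡ-≤ G H X G≤H) (+-comm-≤ H X))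

+-monoʳ-⧏ : ∀ G H X → G ⧏ H → X +g G ⧏ X +g H
+-monoʳ-⧏ G H X G⧏H =
  ≤⧏-trans _ _ _ (+-comm-≤ X G) (⧏≤-trans _ _ _ (+-monoˡ-⧏ G H X G⧏H) (+-comm-≤ H X))

+-mono-≤ : ∀ G H X Y → G ≤g H → X ≤g Y → G +g X ≤g H +g Y
+-mono-≤ G H X Y G≤H X≤Y = ≤-trans _ _ _ (+-monoˡ-≤ G H X G≤H) (+-monoʳ-≤ X Y H X≤Y)

≈g-setoid : Setoid _ _
≈g-setoid = record
  { Carrier = Game
  ; _≈_ = _≈g_
  ; isEquivalence = record
    { refl = λ {G} → ≤-refl G , ≤-refl G
    ; sym = λ (G≤H , H≤G) → H≤G , G≤H
    ; trans = λ {G} {H} {J} (G≤H , H≤G) (H≤J , J≤H) → ≤-trans G H J G≤H H≤J , ≤-trans J H G J≤H H≤G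
    }
  }

open Setoid ≈g-setoid using () renaming (refl to ≈-refl; sym to ≈-sym)
open import Relation.Binary.Reasoning.Setoid ≈g-setoid

+-congʳ : ∀ G H X → G ≈g H → X +g G ≈g X +g H
+-congʳ G H X (G≤H , H≤G) = +-monoʳ-≤ G H X G≤H , +-monoʳ-≤ H G X H≤G

+-comm : ∀ G H → G +g H ≈g H +g G
+-comm G H = +-comm-≤ G H , +-comm-≤ H G

+-assoc : ∀ G H J → (G +g H) +g J ≈g G +g (H +g J)
+-assoc G H J = +-assoc-≤ G H J , +-assoc-≥ G H J

+-identityʳ : ∀ G → G +g 0g ≈g G
+-identityʳ G = +-identityʳ-≤ G , +-identityʳ-≥ G

+-identityˡ : ∀ G → 0g +g G ≈g G
+-identityˡ G = begin 0g +g G ≈⟨ +-comm 0g G ⟩ G +g 0g ≈⟨ +-identityʳ G ⟩ G ∎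

+-inverseʳ : ∀ G → G -g G ≈g 0g
+-inverseʳ G = +-inverseʳ-≤ G , +-inverseʳ-≥ G

+-cancel : ∀ X C → (X +g C) -g C ≈g X
+-cancel X C = begin
  (X +g C) -g C   ≈⟨ +-assoc X C (-g C) ⟩
  X +g (C -g C)   ≈⟨ +-congʳ _ _ X (+-inverseʳ C) ⟩
  X +g 0g         ≈⟨ +-identityʳ X ⟩
  X               ∎

-‿cancel : ∀ X C → (X -g C) +g C ≈g X
-‿cancel X C = begin
  (X -g C) +g C      ≈⟨ +-assoc X (-g C) C ⟩
  X +g ((-g C) +g C) ≈⟨ +-congʳ _ _ X (+-comm (-g C) C) ⟩
  X +g (C -g C)      ≈⟨ +-congʳ _ _ X (+-inverseʳ C) ⟩
  X +g 0g            ≈⟨ +-identityʳ X ⟩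
  X                  ∎

⧏-resp-≈ : ∀ {X X′ Y Y′} → X ≈g X′ → Y ≈g Y′ → X ⧏ Y → X′ ⧏ Y′
⧏-resp-≈ {X} {X′} {Y} {Y′} (_ , X′≤X) (Y≤Y′ , _) X⧏Y = ≤⧏-trans X′ X Y′ X′≤X (⧏≤-trans X Y Y′ X⧏Y Y≤Y′)

⧏-move : ∀ X C Y → X +g C ⧏ Y → X ⧏ Y -g C
⧏-move X C Y X+C⧏Y =
  ⧏-resp-≈ (+-cancel X C) ≈-refl (+-monoˡ-⧏ (X +g C) Y (-g C) X+C⧏Y)

⧏-unmove : ∀ X C Y → X ⧏ Y -g C → X +g C ⧏ Y
⧏-unmove X C Y X⧏Y-C =
  ⧏-resp-≈ ≈-refl (-‿cancel Y C) (+-monoˡ-⧏ X (Y -g C) C X⧏Y-C)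

<-intro : ∀ A B → A ≤g B → A ⧏ B → A <g B
<-intro A B A≤B A⧏B = A≤B , λ B≤A → ≤⧏-absurd B A B≤A A⧏B

<⇒⧏ : ∀ A B → A <g B → A ⧏ B
<⇒⧏ A B (_ , B≰A) = ¬≤⇒⧏ B A B≰A

<-trans : ∀ A B C → A <g B → B <g C → A <g C
<-trans A B C A<B@(A≤B , _) B<C@(B≤C , _) =
  <-intro A C (≤-trans A B C A≤B B≤C) (≤⧏-trans A B C A≤B (<⇒⧏ B C B<C))

+-monoˡ-< : ∀ G H X → G <g H → G +g X <g H +g X
+-monoˡ-< G H X G<H@(G≤H , _) =
  <-intro _ _ (+-monoˡ-≤ G H X G≤H) (+-monoˡ-⧏ G H X (<⇒⧏ G H G<H))

+-monoʳ-< : ∀ G H X → G <g H → X +g G <g X +g H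
+-monoʳ-< G H X G<H@(G≤H , _) =
  <-intro _ _ (+-monoʳ-≤ G H X G≤H) (+-monoʳ-⧏ G H X (<⇒⧏ G H G<H))

-‿anti-< : ∀ G H → G <g H → -g H <g -g G
-‿anti-< G H G<H@(G≤H , _) = <-intro _ _ (-‿anti-≤ G H G≤H) (-‿anti-⧏ G H (<⇒⧏ G H G<H))

number-intro : ∀ {m n} (L : Fin m → Game) (R : Fin n → Game) →
  (∀ i → IsNumber (L i)) → (∀ j → IsNumber (R j)) →
  (∀ i → L i <g ⟨ L ∣ R ⟩) → (∀ j → ⟨ L ∣ R ⟩ <g R j) → IsNumber ⟨ L ∣ R ⟩
number-intro L R numL numR L<G G<R =
  numL , numR , λ i j → <-trans _ _ _ (L<G i) (G<R j)

numberL : ∀ x → IsNumber x → ∀ i → IsNumber (GL x i)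
numberL ⟨ _ ∣ _ ⟩ (numL , _ , _) = numL

numberR : ∀ x → IsNumber x → ∀ j → IsNumber (GR x j)
numberR ⟨ _ ∣ _ ⟩ (_ , numR , _) = numR

numberL≤ : ∀ x → IsNumber x → ∀ i → GL x i ≤g x
numberL≤ x@(⟨ L ∣ R ⟩) (numL , _ , L<R) i =
  ≤-intro (L i) x
    (λ k → ⧏-viaL (GL (L i) k) x i (numberL≤ (L i) (numL i) k))
    (λ j → <⇒⧏ (L i) (R j) (L<R i j))

numberR≥ : ∀ x → IsNumber x → ∀ j → x ≤g GR x j
numberR≥ x@(⟨ L ∣ R ⟩) (_ , numR , L<R) j =
  ≤-intro x (R j)
    (λ i → <⇒⧏ (L i) (R j) (L<R i j))
    (λ k → ⧏-viaR x (GR (R j) k) j (numberR≥ (R j) (numR j) k))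

numberL< : ∀ x → IsNumber x → ∀ i → GL x i <g x
numberL< x nx i = <-intro _ _ (numberL≤ x nx i) (GL⧏ x i)

numberR> : ∀ x → IsNumber x → ∀ j → x <g GR x j
numberR> x nx j = <-intro _ _ (numberR≥ x nx j) (⧏GR x j)

number-⧏⇒≤ : ∀ x y → IsNumber x → IsNumber y → x ⧏ y → x ≤g y
number-⧏⇒≤ x y nx ny x⧏y with ⧏-elim x y x⧏y
... | inj₁ (i , x≤yLi) = ≤-trans x (GL y i) y x≤yLi (numberL≤ y ny i)
... | inj₂ (j , xRj≤y) = ≤-trans x (GR x j) y (numberR≥ x nx j) xRj≤y

number-total : ∀ x y → IsNumber x → IsNumber y → x ≤g y ⊎ y ≤g x
number-total x y nx ny with x ≤? y
... | yes x≤y = inj₁ x≤y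
... | no x≰y = inj₂ (number-⧏⇒≤ y x ny nx (¬≤⇒⧏ x y x≰y))

number-neg : ∀ x → IsNumber x → IsNumber (-g x)
number-neg x@(⟨ L ∣ R ⟩) nx@(numL , numR , _) =
  number-intro _ _
    (λ j → number-neg (R j) (numR j)) (λ i → number-neg (L i) (numL i))
    (λ j → -‿anti-< x (R j) (numberR> x nx j)) (λ i → -‿anti-< (L i) x (numberL< x nx i))

number-+ : ∀ x y → IsNumber x → IsNumber y → IsNumber (x +g y)
number-+ x@(⟨ L ∣ R ⟩) y@(⟨ L′ ∣ R′ ⟩) nx@(numL , numR , _) ny@(numL′ , numR′ , _) =
  number-intro _ _
    (+-leftOptions-ind x y IsNumber
      (λ i → number-+ (L i) y (numL i) ny) (λ i → number-+ x (L′ i) nx (numL′ i)))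
    (+-rightOptions-ind x y IsNumber
      (λ j → number-+ (R j) y (numR j) ny) (λ j → number-+ x (R′ j) nx (numR′ j)))
    (+-leftOptions-ind x y (_<g x +g y)
      (λ i → +-monoˡ-< (L i) x y (numberL< x nx i)) (λ i → +-monoʳ-< (L′ i) y x (numberL< y ny i)))
    (+-rightOptions-ind x y (x +g y <g_)
      (λ j → +-monoˡ-< x (R j) y (numberR> x nx j)) (λ j → +-monoʳ-< y (R′ j) x (numberR> y ny j)))

between : Game → Game → Game
between p q = ⟨_∣_⟩ {1} {1} (λ _ → p) (λ _ → q)

number-between : ∀ p q → IsNumber p → IsNumber q → p ⧏ q → IsNumber (between p q)
number-between p q np nq p⧏q =
  (λ _ → np) , (λ _ → nq) , (λ _ _ → <-intro p q (number-⧏⇒≤ p q np nq p⧏q) p⧏q)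

between-above : ∀ p q → p ⧏ between p q
between-above p q = ⧏-viaL p (between p q) zero (≤-refl p)

between-below : ∀ p q → between p q ⧏ q
between-below p q = ⧏-viaR (between p q) q zero (≤-refl q)

mutual
  leftStop-number : ∀ H x → LeftStop H x → IsNumber x
  leftStop-number ⟨ _ ∣ _ ⟩ x (inj₁ (nx , _)) = nx
  leftStop-number ⟨ L ∣ _ ⟩ x (inj₂ (_ , (i , rs) , _)) = rightStop-number (L i) x rs

  rightStop-number : ∀ H x → RightStop H x → IsNumber x
  rightStop-number ⟨ _ ∣ _ ⟩ x (inj₁ (nx , _)) = nx
  rightStop-number ⟨ _ ∣ R ⟩ x (inj₂ (_ , (j , ls) , _)) = leftStop-number (R j) x ls

leftStop-unique : ∀ H x y → LeftStop H x → LeftStop H y → x ≤g y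
leftStop-unique H@(⟨ _ ∣ _ ⟩) x y (inj₁ (_ , H≈x)) (inj₁ (_ , H≈y)) = ≤-trans x H y (proj₂ H≈x) (proj₁ H≈y)
leftStop-unique ⟨ _ ∣ _ ⟩ x y (inj₁ (nx , H≈x)) (inj₂ (¬E , _)) = ⊥-elim (¬E (x , nx , H≈x))
leftStop-unique ⟨ _ ∣ _ ⟩ x y (inj₂ (¬E , _)) (inj₁ (ny , H≈y)) = ⊥-elim (¬E (y , ny , H≈y))
leftStop-unique ⟨ _ ∣ _ ⟩ x y (inj₂ (_ , (i , rs) , _)) (inj₂ (_ , _ , maximal)) = maximal i x rs

rightStop-unique : ∀ H x y → RightStop H x → RightStop H y → x ≤g y
rightStop-unique H@(⟨ _ ∣ _ ⟩) x y (inj₁ (_ , H≈x)) (inj₁ (_ , H≈y)) = ≤-trans x H y (proj₂ H≈x) (proj₁ H≈y)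
rightStop-unique ⟨ _ ∣ _ ⟩ x y (inj₁ (nx , H≈x)) (inj₂ (¬E , _)) = ⊥-elim (¬E (x , nx , H≈x))
rightStop-unique ⟨ _ ∣ _ ⟩ x y (inj₂ (¬E , _)) (inj₁ (ny , H≈y)) = ⊥-elim (¬E (y , ny , H≈y))
rightStop-unique ⟨ _ ∣ _ ⟩ x y (inj₂ (_ , _ , minimal)) (inj₂ (_ , (j , ls) , _)) = minimal j y ls

negInt : ℕ → Game
negInt zero = 0g
negInt (suc k) = ⟨_∣_⟩ {0} {1} (λ ()) (λ _ → negInt k)

negInt-number : ∀ k → IsNumber (negInt k)
negInt-number zero = (λ ()) , (λ ()) , (λ ())
negInt-number (suc k) = (λ ()) , (λ _ → negInt-number k) , (λ ())

negInt-antitone : ∀ {m n} → m ≤ℕ n → negInt n ≤g negInt m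
negInt-antitone {n = zero} z≤n = (λ ()) , (λ ())
negInt-antitone {n = suc n} z≤n = (λ ()) , (λ ())
negInt-antitone {suc m} {suc n} (s≤s m≤n) =
  (λ ()) , (λ _ → ⧏-viaR (negInt (suc n)) (negInt m) zero (negInt-antitone m≤n))

common-bound : ∀ n (P : Fin n → ℕ → Set) → (∀ j {k k′} → k ≤ℕ k′ → P j k → P j k′) →
               (∀ j → Σ ℕ (P j)) → Σ ℕ (λ K → ∀ j → P j K)
common-bound zero P upward inhabited = 0 , λ ()
common-bound (suc n) P upward inhabited
  with inhabited zero | common-bound n (P ∘ suc) (upward ∘ suc) (inhabited ∘ suc)
... | k₀ , p₀ | K , ps =
  k₀ ⊔ K , λ { zero → upward zero (m≤m⊔n k₀ K) p₀ ; (suc j) → upward (suc j) (m≤n⊔m k₀ K) (ps j) }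

negInt-below : ∀ H → Σ ℕ (λ k → negInt k ≤g H)
negInt-below H@(⟨_∣_⟩ {_} {n} _ R)
  with common-bound n (λ j k → negInt k ≤g R j)
         (λ j k≤k′ negk≤Rj → ≤-trans _ _ (R j) (negInt-antitone k≤k′) negk≤Rj)
         (λ j → negInt-below (R j))
... | K , bound = suc K , (λ ()) , (λ j → ⧏-viaR (negInt (suc K)) (R j) zero (bound j))

-- A game with no Left options equals an integer: the largest -k below it.
noLeft-number : ∀ {n} (L : Fin 0 → Game) (R : Fin n → Game) → EqNumber ⟨ L ∣ R ⟩
noLeft-number L R = descend (proj₁ (negInt-below H)) (proj₂ (negInt-below H))
  where
  H : Game
  H = ⟨ L ∣ R ⟩
  descend : ∀ k → negInt k ≤g H → EqNumber H
  descend zero 0≤H = 0g , negInt-number zero , ((λ ()) , (λ ())) , 0≤H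
  descend (suc k) -k-1≤H with negInt k ≤? H
  ... | yes -k≤H = descend k -k≤H
  ... | no -k≰H =
    negInt (suc k) , negInt-number (suc k) , ((λ ()) , λ _ → ¬≤⇒⧏ (negInt k) H -k≰H) , -k-1≤H

noRight-number : ∀ {m} (L : Fin m → Game) (R : Fin 0 → Game) → EqNumber ⟨ L ∣ R ⟩
noRight-number L R with noLeft-number (λ j → -g (R j)) (λ i → -g (L i))
... | x , nx , (-H≤x , x≤-H) =
  -g x , number-neg x nx ,
  ≤-trans H (-g (-g H)) (-g x) (-‿involutive-≥ H) (-‿anti-≤ x (-g H) x≤-H) ,
  ≤-trans (-g x) (-g (-g H)) H (-‿anti-≤ (-g H) x -H≤x) (-‿involutive-≤ H)
  where
  H : Game
  H = ⟨ L ∣ R ⟩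

finite-max : ∀ {A : Set} (_≼_ : A → A → Set) → (∀ {x y z} → x ≼ y → y ≼ z → x ≼ z) →
             ∀ n (f : Fin (suc n) → A) → (∀ i j → f i ≼ f j ⊎ f j ≼ f i) →
             Σ (Fin (suc n)) (λ k → ∀ i → f i ≼ f k)
finite-max _≼_ trans zero f total = zero , λ { zero → [ id , id ]′ (total zero zero) }
finite-max _≼_ trans (suc n) f total
  with finite-max _≼_ trans n (f ∘ suc) (λ i j → total (suc i) (suc j))
... | k , max with total zero (suc k)
...   | inj₁ f₀≼fk = suc k , λ { zero → f₀≼fk ; (suc i) → max i }
...   | inj₂ fk≼f₀ = zero , λ { zero → [ id , id ]′ (total zero zero) ; (suc i) → trans (max i) fk≼f₀ }

leftStop-from : ∀ {m n} (L : Fin m → Game) (R : Fin n → Game) → Dec (EqNumber ⟨ L ∣ R ⟩) →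
                (∀ i → Σ Game (RightStop (L i))) → Σ Game (LeftStop ⟨ L ∣ R ⟩)
leftStop-from L R (yes (x , nx , H≈x)) _ = x , inj₁ (nx , H≈x)
leftStop-from {zero} L R (no ¬E) _ = ⊥-elim (¬E (noLeft-number L R))
leftStop-from {suc m} L R (no ¬E) stops
  with finite-max _≤g_ (λ {x} {y} {z} → ≤-trans x y z) m (proj₁ ∘ stops)
         (λ i j → number-total _ _ (stop-number i) (stop-number j))
  where
  stop-number : ∀ i → IsNumber (proj₁ (stops i))
  stop-number i = rightStop-number (L i) (proj₁ (stops i)) (proj₂ (stops i))
... | k , max =
  proj₁ (stops k) , inj₂ (¬E , (k , proj₂ (stops k)) ,
    λ i y rs → ≤-trans _ _ _ (rightStop-unique (L i) y _ rs (proj₂ (stops i))) (max i))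

rightStop-from : ∀ {m n} (L : Fin m → Game) (R : Fin n → Game) → Dec (EqNumber ⟨ L ∣ R ⟩) →
                 (∀ j → Σ Game (LeftStop (R j))) → Σ Game (RightStop ⟨ L ∣ R ⟩)
rightStop-from L R (yes (x , nx , H≈x)) _ = x , inj₁ (nx , H≈x)
rightStop-from {n = zero} L R (no ¬E) _ = ⊥-elim (¬E (noRight-number L R))
rightStop-from {n = suc n} L R (no ¬E) stops
  with finite-max (λ x y → y ≤g x) (λ {x} {y} {z} y≤x z≤y → ≤-trans z y x z≤y y≤x) n (proj₁ ∘ stops)
         (λ i j → number-total _ _ (stop-number j) (stop-number i))
  where
  stop-number : ∀ j → IsNumber (proj₁ (stops j))
  stop-number j = leftStop-number (R j) (proj₁ (stops j)) (proj₂ (stops j))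
... | k , min =
  proj₁ (stops k) , inj₂ (¬E , (k , proj₂ (stops k)) ,
    λ j y ls → ≤-trans _ _ _ (min j) (leftStop-unique (R j) _ y (proj₂ (stops j)) ls))

¬¬-all : ∀ n {P : Fin n → Set} → (∀ i → DoubleNegation (P i)) → DoubleNegation (∀ i → P i)
¬¬-all zero _ = pure (λ ())
¬¬-all (suc n) ¬¬P = do
  p₀ ← ¬¬P zero
  ps ← ¬¬-all n (¬¬P ∘ suc)
  pure λ { zero → p₀ ; (suc i) → ps i }

-- Whether a game equals a number is not decidable here,
-- so existence holds in the double-negation sense, which suffices for the
-- decidable conclusions drawn from it below.
mutual
  leftStop-exists : ∀ H → DoubleNegation (Σ Game (LeftStop H))
  leftStop-exists (⟨_∣_⟩ {m} L R) = do
    stops ← ¬¬-all m (λ i → rightStop-exists (L i))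
    number? ← ¬¬-excluded-middle
    pure (leftStop-from L R number? stops)

  rightStop-exists : ∀ H → DoubleNegation (Σ Game (RightStop H))
  rightStop-exists (⟨_∣_⟩ {_} {n} L R) = do
    stops ← ¬¬-all n (λ j → leftStop-exists (R j))
    number? ← ¬¬-excluded-middle
    pure (rightStop-from L R number? stops)

avoid-below : ∀ H z → ¬ EqNumber H → IsNumber z → H ≤g z → Σ _ (λ j → GR H j ≤g z)
avoid-below H z@(⟨ ZL ∣ _ ⟩) ¬E nz H≤z with ⧏-elim H z (¬≤⇒⧏ z H λ z≤H → ¬E (z , nz , H≤z , z≤H))
... | inj₂ viaR = viaR
... | inj₁ (i , H≤ZLi) with avoid-below H (ZL i) ¬E (numberL z nz i) H≤ZLi
...   | j , HRj≤ZLi = j , ≤-trans _ (ZL i) z HRj≤ZLi (numberL≤ z nz i)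

avoid-above : ∀ H z → ¬ EqNumber H → IsNumber z → z ≤g H → Σ _ (λ i → z ≤g GL H i)
avoid-above H z@(⟨ _ ∣ ZR ⟩) ¬E nz z≤H with ⧏-elim z H (¬≤⇒⧏ H z λ H≤z → ¬E (z , nz , H≤z , z≤H))
... | inj₁ viaL = viaL
... | inj₂ (j , ZRj≤H) with avoid-above H (ZR j) ¬E (numberR z nz j) ZRj≤H
...   | i , ZRj≤HLi = i , ≤-trans z (ZR j) _ (numberR≥ z nz j) ZRj≤HLi

mutual
  rightStop-≤ : ∀ H z c → RightStop H c → IsNumber z → H ≤g z → c ≤g z
  rightStop-≤ H@(⟨ _ ∣ _ ⟩) z c (inj₁ (_ , H≈c)) nz H≤z = ≤-trans c H z (proj₂ H≈c) H≤z
  rightStop-≤ H@(⟨ _ ∣ _ ⟩) z c rs@(inj₂ (¬E , _)) nz H≤z with avoid-below H z ¬E nz H≤z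
  ... | j , HRj≤z = rightStop-⧏ H z c rs nz (⧏-viaR H z j HRj≤z)

  leftStop-≤ : ∀ H z c → LeftStop H c → IsNumber z → H ≤g z → c ≤g z
  leftStop-≤ H@(⟨ _ ∣ _ ⟩) z c (inj₁ (_ , H≈c)) nz H≤z = ≤-trans c H z (proj₂ H≈c) H≤z
  leftStop-≤ H@(⟨ L ∣ _ ⟩) z c (inj₂ (_ , (i , rs) , _)) nz H≤z =
    rightStop-⧏ (L i) z c rs nz (≤-elimL H z H≤z i)

  rightStop-⧏ : ∀ H z c → RightStop H c → IsNumber z → H ⧏ z → c ≤g z
  rightStop-⧏ H@(⟨ _ ∣ _ ⟩) z@(⟨ _ ∣ _ ⟩) c (inj₁ (nc , H≈c)) nz H⧏z =
    number-⧏⇒≤ c z nc nz (≤⧏-trans c H z (proj₂ H≈c) H⧏z)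
  rightStop-⧏ H@(⟨ _ ∣ _ ⟩) z@(⟨ ZL ∣ _ ⟩) c rs@(inj₂ _) nz (inj₁ (i , H≤ZLi)) =
    ≤-trans c (ZL i) z (rightStop-≤ H (ZL i) c rs (numberL z nz i) H≤ZLi) (numberL≤ z nz i)
  rightStop-⧏ H@(⟨ _ ∣ R ⟩) z@(⟨ _ ∣ _ ⟩) c (inj₂ (_ , _ , minimal)) nz (inj₂ (j , Rj≤z)) =
    decidable-stable (c ≤? z) (¬¬-map (uncurry λ c′ ls →
      ≤-trans c c′ z (minimal j c′ ls) (leftStop-≤ (R j) z c′ ls nz Rj≤z)) (leftStop-exists (R j)))

mutual
  leftStop-≥ : ∀ H z c → LeftStop H c → IsNumber z → z ≤g H → z ≤g c
  leftStop-≥ H@(⟨ _ ∣ _ ⟩) z c (inj₁ (_ , H≈c)) nz z≤H = ≤-trans z H c z≤H (proj₁ H≈c)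
  leftStop-≥ H@(⟨ _ ∣ _ ⟩) z c ls@(inj₂ (¬E , _)) nz z≤H with avoid-above H z ¬E nz z≤H
  ... | i , z≤HLi = leftStop-⧐ H z c ls nz (⧏-viaL z H i z≤HLi)

  rightStop-≥ : ∀ H z c → RightStop H c → IsNumber z → z ≤g H → z ≤g c
  rightStop-≥ H@(⟨ _ ∣ _ ⟩) z c (inj₁ (_ , H≈c)) nz z≤H = ≤-trans z H c z≤H (proj₁ H≈c)
  rightStop-≥ H@(⟨ _ ∣ R ⟩) z c (inj₂ (_ , (j , ls) , _)) nz z≤H =
    leftStop-⧐ (R j) z c ls nz (≤-elimR z H z≤H j)

  leftStop-⧐ : ∀ H z c → LeftStop H c → IsNumber z → z ⧏ H → z ≤g c
  leftStop-⧐ H@(⟨ _ ∣ _ ⟩) z@(⟨ _ ∣ _ ⟩) c (inj₁ (nc , H≈c)) nz z⧏H =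
    number-⧏⇒≤ z c nz nc (⧏≤-trans z H c z⧏H (proj₁ H≈c))
  leftStop-⧐ H@(⟨ _ ∣ _ ⟩) z@(⟨ _ ∣ ZR ⟩) c ls@(inj₂ _) nz (inj₂ (j , ZRj≤H)) =
    ≤-trans z (ZR j) c (numberR≥ z nz j) (leftStop-≥ H (ZR j) c ls (numberR z nz j) ZRj≤H)
  leftStop-⧐ H@(⟨ L ∣ _ ⟩) z@(⟨ _ ∣ _ ⟩) c (inj₂ (_ , _ , maximal)) nz (inj₁ (i , z≤Li)) =
    decidable-stable (z ≤? c) (¬¬-map (uncurry λ c′ rs →
      ≤-trans z c′ c (rightStop-≥ (L i) z c′ rs nz z≤Li) (maximal i c′ rs)) (rightStop-exists (L i)))

mutual
  below-rightStop⇒≤ : ∀ H y c → RightStop H c → IsNumber y → y ⧏ c → y ≤g H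
  below-rightStop⇒≤ H@(⟨ _ ∣ _ ⟩) y c (inj₁ (nc , H≈c)) ny y⧏c =
    ≤-trans y c H (number-⧏⇒≤ y c ny nc y⧏c) (proj₂ H≈c)
  below-rightStop⇒≤ H@(⟨ _ ∣ R ⟩) y c rs@(inj₂ (_ , _ , minimal)) ny y⧏c =
    ≤-intro y H
      (λ k → ¬≤⇒⧏ H (GL y k) λ H≤yLk →
        ≤⧏-absurd (GL y k) y (numberL≤ y ny k)
          (⧏≤-trans y c (GL y k) y⧏c (rightStop-≤ H (GL y k) c rs (numberL y ny k) H≤yLk)))
      (λ j → decidable-stable (y ⧏? R j) (¬¬-map (uncurry λ c′ ls →
        below-leftStop⇒⧏ (R j) y c′ ls ny (⧏≤-trans y c c′ y⧏c (minimal j c′ ls)))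
        (leftStop-exists (R j))))

  below-leftStop⇒⧏ : ∀ H y c → LeftStop H c → IsNumber y → y ⧏ c → y ⧏ H
  below-leftStop⇒⧏ H@(⟨ _ ∣ _ ⟩) y c (inj₁ (_ , H≈c)) ny y⧏c = ⧏≤-trans y c H y⧏c (proj₂ H≈c)
  below-leftStop⇒⧏ H@(⟨ L ∣ _ ⟩) y c (inj₂ (_ , (i , rs) , _)) ny y⧏c =
    ⧏-viaL y H i (below-rightStop⇒≤ (L i) y c rs ny y⧏c)

mutual
  above-leftStop⇒≥ : ∀ H z c → LeftStop H c → IsNumber z → c ⧏ z → H ≤g z
  above-leftStop⇒≥ H@(⟨ _ ∣ _ ⟩) z c (inj₁ (nc , H≈c)) nz c⧏z =
    ≤-trans H c z (proj₁ H≈c) (number-⧏⇒≤ c z nc nz c⧏z)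
  above-leftStop⇒≥ H@(⟨ L ∣ _ ⟩) z c ls@(inj₂ (_ , _ , maximal)) nz c⧏z =
    ≤-intro H z
      (λ i → decidable-stable (L i ⧏? z) (¬¬-map (uncurry λ c′ rs →
        above-rightStop⇒⧏ (L i) z c′ rs nz (≤⧏-trans c′ c z (maximal i c′ rs) c⧏z))
        (rightStop-exists (L i))))
      (λ k → ¬≤⇒⧏ (GR z k) H λ zRk≤H →
        ≤⧏-absurd z (GR z k) (numberR≥ z nz k)
          (≤⧏-trans (GR z k) c z (leftStop-≥ H (GR z k) c ls (numberR z nz k) zRk≤H) c⧏z))

  above-rightStop⇒⧏ : ∀ H z c → RightStop H c → IsNumber z → c ⧏ z → H ⧏ z
  above-rightStop⇒⧏ H@(⟨ _ ∣ _ ⟩) z c (inj₁ (_ , H≈c)) nz c⧏z = ≤⧏-trans H c z (proj₁ H≈c) c⧏z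
  above-rightStop⇒⧏ H@(⟨ _ ∣ R ⟩) z c (inj₂ (_ , (j , ls) , _)) nz c⧏z =
    ⧏-viaR H z j (above-leftStop⇒≥ (R j) z c ls nz c⧏z)

split-gap : ∀ a b K → IsNumber a → IsNumber b → IsNumber K → K ⧏ a -g b →
  Σ Game λ y → Σ Game λ z →
    IsNumber y × IsNumber z × y ⧏ a × b ⧏ z × 0g ⧏ (y -g z) -g K
split-gap a b K na nb nK K⧏a-b =
  y , z , ny , nz , between-below (z +g K) a , between-above b (a -g K) , 0⧏y-z-K
  where
  b⧏a-K : b ⧏ a -g K
  b⧏a-K = ⧏-move b K a (⧏-resp-≈ (+-comm K b) ≈-refl (⧏-unmove K b a K⧏a-b))
  z : Game
  z = between b (a -g K)
  nz : IsNumber z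
  nz = number-between b (a -g K) nb (number-+ a (-g K) na (number-neg K nK)) b⧏a-K
  y : Game
  y = between (z +g K) a
  ny : IsNumber y
  ny = number-between (z +g K) a (number-+ z K nz nK) na (⧏-unmove z K a (between-below b (a -g K)))
  K⧏y-z : K ⧏ y -g z
  K⧏y-z = ⧏-move K z y (⧏-resp-≈ (+-comm z K) ≈-refl (between-above (z +g K) a))
  0⧏y-z-K : 0g ⧏ (y -g z) -g K
  0⧏y-z-K = ⧏-move 0g K (y -g z) (⧏-resp-≈ (≈-sym (+-identityˡ K)) ≈-refl K⧏y-z)

-- If K ⧏ RS(A) - LS(B) and RS(ε) = 0 then A - B - K + ε ≥ 0: with y, z from
-- split-gap, y ≤ A, B ≤ z and -S ≤ ε for S = (y - z) - K > 0, so
-- 0 ≤ S - S ≤ (A - B - K) + ε.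
gap⇒nonnegative : ∀ A B K ε a b → RightStop A a → LeftStop B b → IsNumber K → RightStop ε 0g →
  K ⧏ a -g b → 0g ≤g ((A -g B) -g K) +g ε
gap⇒nonnegative A B K ε a b rsA lsB nK rsε K⧏a-b
  with split-gap a b K (rightStop-number A a rsA) (leftStop-number B b lsB) nK K⧏a-b
... | y , z , ny , nz , y⧏a , b⧏z , 0⧏S =
  ≤-trans 0g (S -g S) _ (+-inverseʳ-≥ S) (+-mono-≤ S _ (-g S) ε S≤A-B-K -S≤ε)
  where
  S : Game
  S = (y -g z) -g K
  nS : IsNumber S
  nS = number-+ (y -g z) (-g K) (number-+ y (-g z) ny (number-neg z nz)) (number-neg K nK)
  S≤A-B-K : S ≤g (A -g B) -g K
  S≤A-B-K = +-monoˡ-≤ _ _ (-g K) (+-mono-≤ y A (-g z) (-g B)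
              (below-rightStop⇒≤ A y a rsA ny y⧏a)
              (-‿anti-≤ B z (above-leftStop⇒≥ B z b lsB nz b⧏z)))
  -S⧏0 : -g S ⧏ 0g
  -S⧏0 = ⧏≤-trans _ (-g 0g) 0g (-‿anti-⧏ 0g S 0⧏S) ((λ ()) , (λ ()))
  -S≤ε : -g S ≤g ε
  -S≤ε = below-rightStop⇒≤ ε (-g S) 0g rsε (number-neg S nS) -S⧏0

-- A hot game is not equal to a number (its stops would coincide).
hot⇒¬number : ∀ G → Hot G → ¬ EqNumber G
hot⇒¬number ⟨ _ ∣ _ ⟩ (_ , _ , inj₂ (¬E , _) , _ , _) = ¬E
hot⇒¬number ⟨ _ ∣ _ ⟩ (_ , _ , inj₁ _ , inj₂ (¬E , _) , _) = ¬E
hot⇒¬number G@(⟨ _ ∣ _ ⟩) (a , b , inj₁ (_ , G≈a) , inj₁ (_ , G≈b) , (_ , a≰b)) _ =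
  a≰b (≤-trans a G b (proj₂ G≈a) (proj₁ G≈b))

leftStop-option : ∀ G a → ¬ EqNumber G → LeftStop G a → Σ _ (λ i → RightStop (GL G i) a)
leftStop-option ⟨ _ ∣ _ ⟩ a ¬E (inj₁ (na , G≈a)) = ⊥-elim (¬E (a , na , G≈a))
leftStop-option ⟨ _ ∣ _ ⟩ a ¬E (inj₂ (_ , attained , _)) = attained

rightStop-option : ∀ G b → ¬ EqNumber G → RightStop G b → Σ _ (λ j → LeftStop (GR G j) b)
rightStop-option ⟨ _ ∣ _ ⟩ b ¬E (inj₁ (nb , G≈b)) = ⊥-elim (¬E (b , nb , G≈b))
rightStop-option ⟨ _ ∣ _ ⟩ b ¬E (inj₂ (_ , attained , _)) = attained

neg-rightOption : ∀ G j → LeftOption (-g G) (-g GR G j)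
neg-rightOption ⟨ _ ∣ _ ⟩ j = isLeft j

-- If a - b ≰ K, pick G^L and G^R attaining the stops a, b; then
-- (G^L - G^R - K) + ε is a Left option of (G^L - G - K) + ε ≤ 0 and is ≥ 0.
proposition3p13 : (G K ε : Game) → Hot G → IsNumber K → Infinitesimal ε →
    ((i : Fin (nL G)) → ((GL G i -g G) -g K) +g ε ≤g 0g) →
    (a b : Game) → LeftStop G a → RightStop G b → (a -g b) ≤g K
proposition3p13 G K ε hot nK (_ , rsε) hyp a b lsa rsb with (a -g b) ≤? K
... | yes a-b≤K = a-b≤K
... | no a-b≰K
  with leftStop-option G a (hot⇒¬number G hot) lsa | rightStop-option G b (hot⇒¬number G hot) rsb
...   | i , rsA | j , lsB =
  ⊥-elim (≤⧏-absurd _ 0g (hyp i) (⧏-left option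
    (gap⇒nonnegative (GL G i) (GR G j) K ε a b rsA lsB nK rsε (¬≤⇒⧏ (a -g b) K a-b≰K))))
  where
  option : LeftOption (((GL G i -g G) -g K) +g ε) (((GL G i -g GR G j) -g K) +g ε)
  option = +-leftOptionˡ ε (+-leftOptionˡ (-g K) (+-leftOptionʳ (GL G i) (neg-rightOption G j)))
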